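{- Let $\xi$ be an address and $n\in\mathbb N$. Every path of a design of $\mathbb L_n$ is visitable in $\mathbb L_n$.
   Context: Ludics: actions are $(+,\xi,I)$, $(-,\xi,I)$ (address a finite sequence of naturals, $I$ finite set of naturals) or the positive daimon $\maltese$; an action on $\xi.i$ is justified by an action of opposite polarity on $\xi$ whose ramification contains $i$; an action is initial if its address is in the base. Chronicles: nonempty finite alternating sequences on a base, each proper action initial or justified by an earlier one, non-initial negative actions justified by the immediately preceding action, distinct addresses, $\maltese$ only last. View: $\ulcorner\epsilon\urcorner=\epsilon$, $\ulcorner\kappa\urcorner=\kappa$, $\ulcorner w\kappa^+\urcorner=\ulcorner w\urcorner\kappa^+$, $\ulcorner w\kappa^-\urcorner=\ulcorner w_0\urcorner\kappa^-$ with $w_0$ empty if $\kappa^-$ initial, else the prefix of $w$ ending with the justifier of $\kappa^-$. A path is a finite alternating sequence of actions on a base, each proper action initial or justified by an earlier one, each justified positive action having its justifier in the view of the preceding prefix, distinct addresses, $\maltese$ only last, nonempty starting positively for a positive base; it is a path of a design $\mathfrak D$ if the views of all nonempty prefixes are chronicles of $\mathfrak D$. Duals: $\overline{\mathfrak p}$ flips polarities; $\widetilde{w\kappa^+}=\overline{w\kappa^+}\maltese$ (proper positive), $\widetilde{w\kappa^- }=\overline{w\kappa^- }$, $\widetilde{w\maltese}=\overline w$. A path $\mathfrak p$ of a design of a set $E$ (of designs on a common base) is visitable in $E$ if $\widetilde{\mathfrak p}$ is a path and for every prefix $w\kappa^-$ of $\mathfrak p$ with $\kappa^-$ negative and every $\mathfrak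 D\in E$, if $w$ is a path of $\mathfrak D$ then $w\kappa^-$ is a path of $\mathfrak D$. Lists: $\mathbf 0_\tau=\{(+,\tau,\emptyset)\}$, $(\mathbf{k+1})_\tau$ the prefix closure of $\{(+,\tau,\{0\})(-,\tau.0,\{1\})\mathfrak c\mid\mathfrak c\in\mathbf k_{\tau.0.1}\}$; $\mathfrak D^{\epsilon}_\xi=\{(+,\xi,\emptyset)\}$, and for $n>0$, $\mathfrak D^{\langle a_1,\dots,a_n\rangle}_\xi$ is the prefix closure of $\{(+,\xi,\{0,1\})(-,\xi.0,\{1\})\mathfrak c\mid\mathfrak c\in(\mathbf a_1)_{\xi.0.1}\}\cup\{(+,\xi,\{0,1\})(-,\xi.1,\{1\})\mathfrak c\mid\mathfrak c\in\mathfrak D^{\langle a_2,\dots,a_n\rangle}_{\xi.1.1}\}$; $\mathbb L_n=\{\mathfrak D^{\langle a_1,\dots,a_n\rangle}_\xi\mid a_i\in\mathbb N\}$. -}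

module Defs where

open import Data.Nat using (ℕ; zero; suc) renaming (_≟_ to _≟ℕ_)
open import Data.List using (List; []; _∷_; _++_; [_]; reverse)
open import Data.List.Properties using (≡-dec)
open import Data.List.Membership.Propositional using (_∈_)
open import Data.List.Relation.Unary.Any using (Any; any?)
open import Data.List.Relation.Unary.Unique.Propositional using (Unique)
open import Data.Vec using (Vec; toList)
open import Data.Product using (Σ; _×_; _,_)
open import Data.Product.Properties using ()
open import Data.Sum using (_⊎_)
open import Data.Unit using (⊤)
open import Data.Empty using (⊥)
open import Data.Bool using (Bool; true; false; if_then_else_)
open import Relation.Binary.PropositionalEquality using (_≡_; _≢_; refl)
open import Relation.Nullary using (Dec; yes; no; ¬_; does)
open import Relation.Nullary.Decidable using (_×-dec_; ¬?)

Address : Set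
Address = List ℕ

_∙_ : Address → ℕ → Address
ξ ∙ i = ξ ++ [ i ]

data Pol : Set where
  pos neg : Pol

_≟Pol_ : (p q : Pol) → Dec (p ≡ q)
pos ≟Pol pos = yes refl
pos ≟Pol neg = no (λ ())
neg ≟Pol pos = no (λ ())
neg ≟Pol neg = yes refl

flipPol : Pol → Pol
flipPol pos = neg
flipPol neg = pos

-- A proper action (±, ξ, I), where the finite set I ⊆ ℕ is represented by
-- the list of its elements (in strictly increasing order), or the daimon.
data Action : Set where
  act : Pol → Address → List ℕ → Action
  ✠   : Action

polarity : Action → Pol
polarity (act p _ _) = p
polarity ✠ = pos

addresses : List Action → List Address
addresses [] = []
addresses (act _ ζ _ ∷ w) = ζ ∷ addresses w
addresses (✠ ∷ w) = addresses w

Justifies : Action → Action → Set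
Justifies (act p ξ I) (act q ζ J) = (p ≢ q) × Any (λ i → ζ ≡ ξ ∙ i) I
Justifies (act _ _ _) ✠ = ⊥
Justifies ✠ _ = ⊥

justifies? : (a b : Action) → Dec (Justifies a b)
justifies? (act p ξ I) (act q ζ J) =
  ¬? (p ≟Pol q) ×-dec any? (λ i → ≡-dec _≟ℕ_ ζ (ξ ∙ i)) I
justifies? (act _ _ _) ✠ = no (λ ())
justifies? ✠ (act _ _ _) = no (λ ())
justifies? ✠ ✠ = no (λ ())

record Base : Set where
  constructor base
  field
    basePol  : Pol
    baseAddr : Address
open Base public

⊢_ : Address → Base
⊢ ξ = base pos ξ

_⊢ : Address → Base
ξ ⊢ = base neg ξ

Initial : Base → Action → Set
Initial B (act p ζ I) = (ζ ≡ baseAddr B) × (p ≡ basePol B)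
Initial B ✠ = ⊥

initial? : (B : Base) → (a : Action) → Dec (Initial B a)
initial? B (act p ζ I) = ≡-dec _≟ℕ_ ζ (baseAddr B) ×-dec (p ≟Pol basePol B)
initial? B ✠ = no (λ ())

-- Views.  view' works on reversed sequences (last action first).

mutual
  view' : Base → List Action → List Action
  view' B [] = []
  view' B (κ ∷ rw) = viewStep B κ (polarity κ) rw

  viewStep : Base → Action → Pol → List Action → List Action
  viewStep B κ pos rw = κ ∷ view' B rw
  viewStep B κ neg rw =
    if does (initial? B κ) then κ ∷ [] else κ ∷ viewFrom B κ rw

  viewFrom : Base → Action → List Action → List Action
  viewFrom B κ [] = []
  viewFrom B κ (a ∷ rw) =
    if does (justifies? a κ) then view' B (a ∷ rw) else viewFrom B κ rw

view : Base → List Action → List Action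
view B w = reverse (view' B (reverse w))

StartsOK : Base → List Action → Set
StartsOK (base pos ξ) w = Σ Action λ κ → Σ (List Action) λ v → (w ≡ κ ∷ v) × (polarity κ ≡ pos)
StartsOK (base neg ξ) w = ⊤

record IsPath (B : Base) (w : List Action) : Set where
  field
    alternating : ∀ u κ κ' v → w ≡ u ++ κ ∷ κ' ∷ v → polarity κ ≢ polarity κ'
    justified   : ∀ u p ζ I v → w ≡ u ++ act p ζ I ∷ v →
                  Initial B (act p ζ I) ⊎ Σ Action (λ a → (a ∈ u) × Justifies a (act p ζ I))
    justInView  : ∀ u ζ I v → w ≡ u ++ act pos ζ I ∷ v →
                  ∀ a → a ∈ u → Justifies a (act pos ζ I) → a ∈ view B u
    distinct    : Unique (addresses w)
    daimonLast  : ∀ u v → w ≡ u ++ ✠ ∷ v → v ≡ []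
    start       : StartsOK B w

-- a design is given by its set of chronicles
Design : Set₁
Design = List Action → Set

PathOf : Base → Design → List Action → Set
PathOf B D w = IsPath B w × (∀ u v → w ≡ u ++ v → u ≢ [] → D (view B u))

flipA : Action → Action
flipA (act p ζ I) = act (flipPol p) ζ I
flipA ✠ = ✠

dual : List Action → List Action
dual [] = []
dual (act pos ζ I ∷ []) = act neg ζ I ∷ ✠ ∷ []
dual (act neg ζ I ∷ []) = act pos ζ I ∷ []
dual (✠ ∷ []) = []
dual (κ ∷ κ' ∷ w) = flipA κ ∷ dual (κ' ∷ w)

-- visitability of a path p (on base ⊢ ξ) in a set E of designs on ⊢ ξ,
-- the set being given as a family indexed by J
Visitable : {J : Set} → Address → (J → Design) → List Action → Set
Visitable {J} ξ E p =
  IsPath (ξ ⊢) (dual p) ×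
  (∀ w ζ I v → p ≡ w ++ act neg ζ I ∷ v → ∀ (j : J) →
     PathOf (⊢ ξ) (E j) w → PathOf (⊢ ξ) (E j) (w ++ [ act neg ζ I ]))

PrefixClosure : Design → Design
PrefixClosure S c = (c ≢ []) × Σ (List Action) λ s → S s × Σ (List Action) λ v → s ≡ c ++ v

natD : ℕ → Address → Design
natD zero τ c = c ≡ [ act pos τ [] ]
natD (suc k) τ = PrefixClosure λ s →
  Σ (List Action) λ c → natD k ((τ ∙ 0) ∙ 1) c ×
    (s ≡ act pos τ (0 ∷ []) ∷ act neg (τ ∙ 0) (1 ∷ []) ∷ c)

listD : List ℕ → Address → Design
listD [] ξ c = c ≡ [ act pos ξ [] ]
listD (a ∷ as) ξ = PrefixClosure λ s →
  (Σ (List Action) λ c → natD a ((ξ ∙ 0) ∙ 1) c ×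
     (s ≡ act pos ξ (0 ∷ 1 ∷ []) ∷ act neg (ξ ∙ 0) (1 ∷ []) ∷ c)) ⊎
  (Σ (List Action) λ c → listD as ((ξ ∙ 1) ∙ 1) c ×
     (s ≡ act pos ξ (0 ∷ 1 ∷ []) ∷ act neg (ξ ∙ 1) (1 ∷ []) ∷ c))

𝕃 : Address → (n : ℕ) → Vec ℕ n → Design
𝕃 ξ n as = listD (toList as) ξ

module Submission where

-- The argument rests on one structural fact about list designs: all their
-- chronicles start with a positive action on ξ and are linked (each action
-- justifies the next), and every negative action has ramification {1}.
-- Moreover each list design is saturated: whenever a chronicle ends with a
-- positive action, it contains every negative action (with ramification {1})
-- justified by it.  Consequently a negative action extending a chronicle of
-- one list design extends that chronicle in any other list design containing
-- it (negative-extension); this gives the second half of visitability, since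
-- the view of w κ⁻ is κ⁻ appended to the view of a prefix of w.
-- For the first half, linkedness of the views of p shows that p contains no
-- daimon and that each positive action after the first is justified by its
-- predecessor; hence every prefix of the flipped sequence is its own view on
-- the negative base, the flip of p is a path there, and so is the dual
-- (the flip, followed by the daimon if p ends positively).

open import Defs
open import Data.Nat using (ℕ; zero; suc)
open import Data.List using (List; []; _∷_; _++_; [_]; _∷ʳ_; map; reverse; initLast; _∷ʳ′_)
open import Data.List.Properties
  using (∷-injective; ∷-injectiveˡ; ∷-injectiveʳ; ++-assoc; ++-identityʳ; ++-conicalˡ; ∷ʳ-++; ∷ʳ-injectiveʳ;
         map-++; map-∘; map-cong; map-id; reverse-++; unfold-reverse; reverse-involutive)
open import Data.List.Reverse using (Reverse; []; _∶_∶ʳ_; reverseView)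
open import Data.List.Relation.Unary.All as All using (All; []; _∷_)
open import Data.List.Relation.Unary.All.Properties using (++⁻ˡ; ++⁻ʳ)
open import Data.List.Relation.Unary.AllPairs using ([]; _∷_)
open import Data.List.Relation.Unary.Any using (Any; here; there)
open import Data.List.Relation.Unary.Unique.Propositional using (Unique)
open import Data.List.Membership.Propositional using (_∈_)
open import Data.List.Membership.Propositional.Properties using (∈-map⁺)
open import Data.Vec using (Vec; toList)
open import Data.Product using (Σ; _×_; _,_)
open import Data.Sum using (_⊎_; inj₁; inj₂)
open import Data.Empty using (⊥-elim)
open import Data.Unit using (⊤; tt)
open import Relation.Binary.PropositionalEquality
  using (_≡_; _≢_; refl; sym; trans; cong; subst; module ≡-Reasoning)
open import Relation.Nullary using (¬_; yes; no)

open ≡-Reasoning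

++-∷≢[] : ∀ {A : Set} (u : List A) {x : A} v → u ++ x ∷ v ≢ []
++-∷≢[] [] v ()
++-∷≢[] (_ ∷ u) v ()

unique-prefix : ∀ {A : Set} (u : List A) {v} → Unique (u ++ v) → Unique u
unique-prefix [] _ = []
unique-prefix (x ∷ u) (x∉ ∷ d) = ++⁻ˡ u x∉ ∷ unique-prefix u d

∷ʳ-split : ∀ {A : Set} (xs : List A) y u k v → xs ∷ʳ y ≡ u ++ k ∷ v →
           (u ≡ xs × k ≡ y × v ≡ []) ⊎ Σ (List A) λ v' → xs ≡ u ++ k ∷ v'
∷ʳ-split [] y [] k v refl = inj₁ (refl , refl , refl)
∷ʳ-split [] y (_ ∷ u) k v eq = ⊥-elim (++-∷≢[] u v (sym (∷-injectiveʳ eq)))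
∷ʳ-split (x ∷ xs) y [] k v refl = inj₂ (xs , refl)
∷ʳ-split (x ∷ xs) y (z ∷ u) k v eq with ∷-injective eq
... | refl , eq' with ∷ʳ-split xs y u k v eq'
...   | inj₁ (refl , refl , refl) = inj₁ (refl , refl , refl)
...   | inj₂ (v' , refl) = inj₂ (v' , refl)

∷ʳ-prefix : ∀ {A : Set} (xs : List A) y u v → xs ∷ʳ y ≡ u ++ v →
            u ≡ xs ∷ʳ y ⊎ Σ (List A) λ v' → xs ≡ u ++ v'
∷ʳ-prefix xs y u [] eq = inj₁ (sym (trans eq (++-identityʳ u)))
∷ʳ-prefix xs y u (k ∷ v) eq with ∷ʳ-split xs y u k v eq
... | inj₁ (refl , _ , _) = inj₂ ([] , sym (++-identityʳ u))
... | inj₂ (v' , e) = inj₂ (k ∷ v' , e)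

Linked : List Action → Set
Linked [] = ⊤
Linked (_ ∷ []) = ⊤
Linked (x ∷ y ∷ c) = Justifies x y × Linked (y ∷ c)

linked-prefix : ∀ u {v} → Linked (u ++ v) → Linked u
linked-prefix [] _ = tt
linked-prefix (_ ∷ []) _ = tt
linked-prefix (_ ∷ y ∷ u) (j , l) = j , linked-prefix (y ∷ u) l

linked-at : ∀ u y x v → Linked (u ++ y ∷ x ∷ v) → Justifies y x
linked-at [] y x v (j , _) = j
linked-at (_ ∷ []) y x v (_ , l) = linked-at [] y x v l
linked-at (_ ∷ z ∷ u) y x v (_ , l) = linked-at (z ∷ u) y x v l

UnaryNeg : Action → Set
UnaryNeg (act pos _ _) = ⊤
UnaryNeg (act neg _ J) = J ≡ 1 ∷ []
UnaryNeg ✠ = ⊤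

record ListChronicle (τ : Address) (c : List Action) : Set where
  field
    rootFirst : Σ (List ℕ) λ I → Σ (List Action) λ r → c ≡ act pos τ I ∷ r
    linked    : Linked c
    unary     : All UnaryNeg c
open ListChronicle

chronicle-prefix : ∀ {τ} u {v} → ListChronicle τ (u ++ v) → u ≢ [] → ListChronicle τ u
chronicle-prefix [] _ ne = ⊥-elim (ne refl)
chronicle-prefix (x ∷ u) ch _ with rootFirst ch
... | I , _ , refl = record
  { rootFirst = I , u , refl
  ; linked    = linked-prefix (x ∷ u) (linked ch)
  ; unary     = ++⁻ˡ (x ∷ u) (unary ch) }

leaf-chronicle : ∀ τ → ListChronicle τ [ act pos τ [] ]
leaf-chronicle τ = record { rootFirst = _ , _ , refl ; linked = tt ; unary = tt ∷ [] }

extend-chronicle : ∀ {τ I i c} → Any (λ j → τ ∙ i ≡ τ ∙ j) I → ListChronicle ((τ ∙ i) ∙ 1) c →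
                   ListChronicle τ (act pos τ I ∷ act neg (τ ∙ i) (1 ∷ []) ∷ c)
extend-chronicle i∈I record { rootFirst = _ , _ , refl ; linked = l ; unary = un } = record
  { rootFirst = _ , _ , refl
  ; linked    = ((λ ()) , i∈I) , ((λ ()) , here refl) , l
  ; unary     = tt ∷ refl ∷ un }

closure-chronicle : ∀ {τ} (S : Design) → (∀ s → S s → ListChronicle τ s) →
                    ∀ c → PrefixClosure S c → ListChronicle τ c
closure-chronicle S chr c (ne , s , Ss , v , refl) = chronicle-prefix c (chr s Ss) ne

natD-chronicle : ∀ k τ c → natD k τ c → ListChronicle τ c
natD-chronicle zero τ _ refl = leaf-chronicle τ
natD-chronicle (suc k) τ = closure-chronicle _ branch
  where
  branch : ∀ s → _ → ListChronicle τ s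
  branch _ (c₀ , n₀ , refl) = extend-chronicle (here refl) (natD-chronicle k _ c₀ n₀)

listD-chronicle : ∀ l ξ c → listD l ξ c → ListChronicle ξ c
listD-chronicle [] ξ _ refl = leaf-chronicle ξ
listD-chronicle (a ∷ as) ξ = closure-chronicle _ branch
  where
  branch : ∀ s → _ → ListChronicle ξ s
  branch _ (inj₁ (c₀ , n₀ , refl)) = extend-chronicle (here refl) (natD-chronicle a _ c₀ n₀)
  branch _ (inj₂ (c₀ , l₀ , refl)) = extend-chronicle (there (here refl)) (listD-chronicle as _ c₀ l₀)

chronicle-last-justified : ∀ {τ} c y x → ListChronicle τ (c ∷ʳ y ∷ʳ x) → Justifies y x
chronicle-last-justified c y x ch =
  linked-at c y x [] (subst Linked (++-assoc c [ y ] [ x ]) (linked ch))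

chronicle-negative-first : ∀ {τ ζ J r} → ¬ ListChronicle τ (act neg ζ J ∷ r)
chronicle-negative-first ch with rootFirst ch
... | _ , _ , ()

-- ... nor ends with the daimon, which no action justifies (the case split on
-- the predecessor lets Justifies compute).
chronicle-daimon-free : ∀ {τ} c → ¬ ListChronicle τ (c ∷ʳ ✠)
chronicle-daimon-free c ch with initLast c
chronicle-daimon-free _ ch | [] with rootFirst ch
... | _ , _ , ()
chronicle-daimon-free _ ch | c' ∷ʳ′ act _ _ _ = chronicle-last-justified c' _ ✠ ch
chronicle-daimon-free _ ch | c' ∷ʳ′ ✠ = chronicle-last-justified c' _ ✠ ch

PrefixClosed : Design → Set
PrefixClosed D = ∀ u v → D (u ++ v) → u ≢ [] → D u

closure-closed : ∀ S → PrefixClosed (PrefixClosure S)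
closure-closed S u v (_ , s , Ss , w , e) ne = ne , s , Ss , v ++ w , trans e (++-assoc u v w)

leaf-closed : ∀ τ → PrefixClosed (λ c → c ≡ [ act pos τ [] ])
leaf-closed τ [] v e ne = ⊥-elim (ne refl)
leaf-closed τ (x ∷ u) v e ne with ∷-injective e
... | refl , e' = cong (x ∷_) (++-conicalˡ u v e')

natD-closed : ∀ k τ → PrefixClosed (natD k τ)
natD-closed zero τ = leaf-closed τ
natD-closed (suc k) τ = closure-closed _

listD-closed : ∀ l ξ → PrefixClosed (listD l ξ)
listD-closed [] ξ = leaf-closed ξ
listD-closed (a ∷ as) ξ = closure-closed _

in-closure : ∀ (S : Design) s → S s → s ≢ [] → PrefixClosure S s
in-closure S s Ss ne = ne , s , Ss , [] , sym (++-identityʳ s)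

-- Every natD and listD has a chronicle (witnesses needed to prove membership
-- of prefixes).
natD-inhabited : ∀ k τ → Σ (List Action) (natD k τ)
natD-inhabited zero τ = _ , refl
natD-inhabited (suc k) τ with natD-inhabited k ((τ ∙ 0) ∙ 1)
... | c , h = _ , in-closure _ _ (c , h , refl) (λ ())

listD-inhabited : ∀ l ξ → Σ (List Action) (listD l ξ)
listD-inhabited [] ξ = _ , refl
listD-inhabited (a ∷ as) ξ with natD-inhabited a ((ξ ∙ 0) ∙ 1)
... | c , h = _ , in-closure _ _ (inj₁ (c , h , refl)) (λ ())

Saturated : Design → Set
Saturated D = ∀ c y ζ → D (c ∷ʳ y) → Justifies y (act neg ζ (1 ∷ [])) →
              D (c ∷ʳ y ∷ʳ act neg ζ (1 ∷ []))

leaf-saturated : ∀ τ → Saturated (λ c → c ≡ [ act pos τ [] ])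
leaf-saturated τ [] _ ζ refl (_ , ())
leaf-saturated τ (_ ∷ []) _ ζ () _
leaf-saturated τ (_ ∷ _ ∷ _) _ ζ () _

natD-saturated : ∀ k τ → Saturated (natD k τ)
natD-saturated zero τ = leaf-saturated τ
natD-saturated (suc k) τ [] _ _ (_ , _ , (c₀ , n₀ , refl) , _ , refl) (_ , here refl) =
  (λ ()) , _ , (c₀ , n₀ , refl) , c₀ , refl
natD-saturated (suc k) τ (_ ∷ []) _ _ (_ , _ , (_ , _ , refl) , _ , refl) (neg≢neg , _) =
  ⊥-elim (neg≢neg refl)
natD-saturated (suc k) τ (_ ∷ _ ∷ c) y ζ (_ , _ , (_ , n₀ , refl) , v , refl) j =
  in-closure _ _ (_ , sub , refl) (λ ())
  where
  sub = natD-saturated k _ c y ζ (natD-closed k _ (c ∷ʳ y) v n₀ (++-∷≢[] c [])) j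

listD-root : ∀ a as ξ y v → listD (a ∷ as) ξ (y ∷ v) → y ≡ act pos ξ (0 ∷ 1 ∷ [])
listD-root a as ξ y v (_ , _ , inj₁ (_ , _ , refl) , _ , e) = sym (∷-injectiveˡ e)
listD-root a as ξ y v (_ , _ , inj₂ (_ , _ , refl) , _ , e) = sym (∷-injectiveˡ e)

listD-root-saturated : ∀ a as ξ ζ → Justifies (act pos ξ (0 ∷ 1 ∷ [])) (act neg ζ (1 ∷ [])) →
                       listD (a ∷ as) ξ (act pos ξ (0 ∷ 1 ∷ []) ∷ act neg ζ (1 ∷ []) ∷ [])
listD-root-saturated a as ξ _ (_ , here refl) with natD-inhabited a ((ξ ∙ 0) ∙ 1)
... | c , h = (λ ()) , _ , inj₁ (c , h , refl) , c , refl
listD-root-saturated a as ξ _ (_ , there (here refl)) with listD-inhabited as ((ξ ∙ 1) ∙ 1)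
... | c , h = (λ ()) , _ , inj₂ (c , h , refl) , c , refl

listD-saturated : ∀ l ξ → Saturated (listD l ξ)
listD-saturated [] ξ = leaf-saturated ξ
listD-saturated (a ∷ as) ξ [] y ζ h j with listD-root a as ξ y [] h
... | refl = listD-root-saturated a as ξ ζ j
listD-saturated (a ∷ as) ξ (_ ∷ []) _ _ (_ , _ , inj₁ (_ , _ , refl) , _ , refl) (neg≢neg , _) =
  ⊥-elim (neg≢neg refl)
listD-saturated (a ∷ as) ξ (_ ∷ []) _ _ (_ , _ , inj₂ (_ , _ , refl) , _ , refl) (neg≢neg , _) =
  ⊥-elim (neg≢neg refl)
listD-saturated (a ∷ as) ξ (_ ∷ _ ∷ c) y ζ (_ , _ , inj₁ (_ , n₀ , refl) , v , refl) j =
  in-closure _ _ (inj₁ (_ , sub , refl)) (λ ())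
  where
  sub = natD-saturated a _ c y ζ (natD-closed a _ (c ∷ʳ y) v n₀ (++-∷≢[] c [])) j
listD-saturated (a ∷ as) ξ (_ ∷ _ ∷ c) y ζ (_ , _ , inj₂ (_ , l₀ , refl) , v , refl) j =
  in-closure _ _ (inj₂ (_ , sub , refl)) (λ ())
  where
  sub = listD-saturated as _ c y ζ (listD-closed as _ (c ∷ʳ y) v l₀ (++-∷≢[] c [])) j

negative-extension : ∀ l cs ξ c ζ J → listD l ξ (c ∷ʳ act neg ζ J) → listD cs ξ c →
                     listD cs ξ (c ∷ʳ act neg ζ J)
negative-extension l cs ξ c ζ J h h' with initLast c
... | [] = ⊥-elim (chronicle-negative-first (listD-chronicle l ξ _ h))
... | c' ∷ʳ′ y with All.head (++⁻ʳ (c' ∷ʳ y) (unary (listD-chronicle l ξ _ h)))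
...   | refl = listD-saturated cs ξ c' y ζ h' (chronicle-last-justified c' y _ (listD-chronicle l ξ _ h))

-- Views are computed on the reversed sequence; appending x means prepending it there.
view-snoc : ∀ B u x → view B (u ∷ʳ x) ≡ reverse (view' B (x ∷ reverse u))
view-snoc B u x = cong (λ r → reverse (view' B r)) (reverse-++ u [ x ])

viewStep-head : ∀ B x p rw → Σ (List Action) λ r → viewStep B x p rw ≡ x ∷ r
viewStep-head B x pos rw = _ , refl
viewStep-head B x neg rw with initial? B x
... | yes _ = _ , refl
... | no _ = _ , refl

view-last : ∀ B u x → Σ (List Action) λ c → view B (u ∷ʳ x) ≡ c ∷ʳ x
view-last B u x with viewStep-head B x (polarity x) (reverse u)
... | r , e = reverse r , trans (view-snoc B u x) (trans (cong reverse e) (unfold-reverse x r))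

view-singleton : ∀ B x → view B [ x ] ≡ [ x ]
view-singleton B x = cong reverse (single (polarity x))
  where
  single : ∀ p → viewStep B x p [] ≡ [ x ]
  single pos = refl
  single neg with initial? B x
  ... | yes _ = refl
  ... | no _ = refl

view-extends : ∀ B w x → view' B (x ∷ reverse w) ≡ x ∷ view' B (reverse w) →
               view B (w ∷ʳ x) ≡ view B w ∷ʳ x
view-extends B w x e = begin
  view B (w ∷ʳ x)                   ≡⟨ view-snoc B w x ⟩
  reverse (view' B (x ∷ reverse w)) ≡⟨ cong reverse e ⟩
  reverse (x ∷ view' B (reverse w)) ≡⟨ unfold-reverse x (view' B (reverse w)) ⟩
  view B w ∷ʳ x                     ∎

view-positive : ∀ B w x → polarity x ≡ pos → view B (w ∷ʳ x) ≡ view B w ∷ʳ x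
view-positive B w x px = view-extends B w x (cong (λ p → viewStep B x p (reverse w)) px)

view'-justified : ∀ B x y rw → polarity x ≡ neg → ¬ Initial B x → Justifies y x →
                  view' B (x ∷ y ∷ rw) ≡ x ∷ view' B (y ∷ rw)
view'-justified B x y rw px ni j = trans (cong (λ p → viewStep B x p (y ∷ rw)) px) step
  where
  step : viewStep B x neg (y ∷ rw) ≡ x ∷ view' B (y ∷ rw)
  step with initial? B x
  ... | yes i = ⊥-elim (ni i)
  ... | no _ with justifies? y x
  ...   | yes _ = refl
  ...   | no nj = ⊥-elim (nj j)

view-justified : ∀ B u y x → polarity x ≡ neg → ¬ Initial B x → Justifies y x →
                 view B (u ∷ʳ y ∷ʳ x) ≡ view B (u ∷ʳ y) ∷ʳ x
view-justified B u y x px ni j =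
  view-extends B (u ∷ʳ y) x
    (subst (λ r → view' B (x ∷ r) ≡ x ∷ view' B r) (sym (reverse-++ u [ y ]))
           (view'-justified B x y (reverse u) px ni j))

viewFrom-cases : ∀ B x rw → viewFrom B x rw ≡ [] ⊎
  Σ (List Action) λ r₁ → Σ (List Action) λ r₂ → rw ≡ r₁ ++ r₂ × r₂ ≢ [] × viewFrom B x rw ≡ view' B r₂
viewFrom-cases B x [] = inj₁ refl
viewFrom-cases B x (a ∷ rw) with justifies? a x
... | yes _ = inj₂ ([] , a ∷ rw , refl , (λ ()) , refl)
... | no _ with viewFrom-cases B x rw
...   | inj₁ e = inj₁ e
...   | inj₂ (r₁ , r₂ , refl , ne , e) = inj₂ (a ∷ r₁ , r₂ , refl , ne , e)

-- On a positive base a negative action is never initial, so the view of w κ⁻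
-- is κ⁻ preceded by the view of the prefix of w ending at its justifier, or
-- by nothing when no justifier occurs in w.
viewStep-negative : ∀ ξ x rw → polarity x ≡ neg → viewStep (⊢ ξ) x neg rw ≡ x ∷ viewFrom (⊢ ξ) x rw
viewStep-negative ξ x rw px with initial? (⊢ ξ) x
viewStep-negative ξ (act _ _ _) rw refl | yes (_ , ())
... | no _ = refl

view-negative-unfold : ∀ ξ w x → polarity x ≡ neg →
                       view (⊢ ξ) (w ∷ʳ x) ≡ reverse (viewFrom (⊢ ξ) x (reverse w)) ∷ʳ x
view-negative-unfold ξ w x px = begin
  view (⊢ ξ) (w ∷ʳ x)                                ≡⟨ view-snoc (⊢ ξ) w x ⟩
  reverse (viewStep (⊢ ξ) x (polarity x) (reverse w)) ≡⟨ cong (λ p → reverse (viewStep (⊢ ξ) x p (reverse w))) px ⟩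
  reverse (viewStep (⊢ ξ) x neg (reverse w))          ≡⟨ cong reverse (viewStep-negative ξ x (reverse w) px) ⟩
  reverse (x ∷ viewFrom (⊢ ξ) x (reverse w))          ≡⟨ unfold-reverse x (viewFrom (⊢ ξ) x (reverse w)) ⟩
  reverse (viewFrom (⊢ ξ) x (reverse w)) ∷ʳ x         ∎

view-negative : ∀ ξ w ζ I →
  view (⊢ ξ) (w ∷ʳ act neg ζ I) ≡ [ act neg ζ I ] ⊎
  Σ (List Action) λ w₀ → Σ (List Action) λ w₁ →
    w ≡ w₀ ++ w₁ × w₀ ≢ [] × view (⊢ ξ) (w ∷ʳ act neg ζ I) ≡ view (⊢ ξ) w₀ ∷ʳ act neg ζ I
view-negative ξ w ζ I with viewFrom-cases (⊢ ξ) (act neg ζ I) (reverse w)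
... | inj₁ e = inj₁ (trans (view-negative-unfold ξ w _ refl) (cong (λ r → reverse r ∷ʳ act neg ζ I) e))
... | inj₂ (r₁ , r₂ , erw , ne , e) = inj₂ (reverse r₂ , reverse r₁ , split , nonempty , viewEq)
  where
  split : w ≡ reverse r₂ ++ reverse r₁
  split = begin
    w                         ≡⟨ sym (reverse-involutive w) ⟩
    reverse (reverse w)       ≡⟨ cong reverse erw ⟩
    reverse (r₁ ++ r₂)        ≡⟨ reverse-++ r₁ r₂ ⟩
    reverse r₂ ++ reverse r₁  ∎
  nonempty : reverse r₂ ≢ []
  nonempty e₂ = ne (trans (sym (reverse-involutive r₂)) (cong reverse e₂))
  x = act neg ζ I
  viewEq : view (⊢ ξ) (w ∷ʳ x) ≡ view (⊢ ξ) (reverse r₂) ∷ʳ x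
  viewEq = begin
    view (⊢ ξ) (w ∷ʳ x)                                 ≡⟨ view-negative-unfold ξ w x refl ⟩
    reverse (viewFrom (⊢ ξ) x (reverse w)) ∷ʳ x         ≡⟨ cong (λ r → reverse r ∷ʳ x) e ⟩
    reverse (view' (⊢ ξ) r₂) ∷ʳ x                       ≡⟨ cong (λ r → reverse (view' (⊢ ξ) r) ∷ʳ x)
                                                                 (sym (reverse-involutive r₂)) ⟩
    view (⊢ ξ) (reverse r₂) ∷ʳ x                        ∎

SelfJustifying : Base → List Action → Set
SelfJustifying B w = ∀ u y x v → w ≡ u ++ y ∷ x ∷ v → polarity x ≡ neg → ¬ Initial B x × Justifies y x

self-justifying-view : ∀ B w → SelfJustifying B w → ∀ u v → w ≡ u ++ v → view B u ≡ u
self-justifying-view B w sj u v e = prefix (reverseView u) v e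
  where
  step : ∀ {u} → Reverse u → ∀ x v → w ≡ u ++ x ∷ v → view B (u ∷ʳ x) ≡ view B u ∷ʳ x
  step [] x v _ = view-singleton B x
  step (u ∶ _ ∶ʳ y) x v e with polarity x in px
  ... | pos = view-positive B (u ∷ʳ y) x px
  ... | neg with sj u y x v (trans e (∷ʳ-++ u y (x ∷ v))) px
  ...   | ni , j = view-justified B u y x px ni j

  prefix : ∀ {u} → Reverse u → ∀ v → w ≡ u ++ v → view B u ≡ u
  prefix [] v e = refl
  prefix (u ∶ ru ∶ʳ x) v e =
    trans (step ru x v e') (cong (_∷ʳ x) (prefix ru (x ∷ v) e'))
    where
    e' : w ≡ u ++ x ∷ v
    e' = trans e (∷ʳ-++ u x v)

addresses-++ : ∀ u v → addresses (u ++ v) ≡ addresses u ++ addresses v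
addresses-++ [] v = refl
addresses-++ (act _ ζ _ ∷ u) v = cong (ζ ∷_) (addresses-++ u v)
addresses-++ (✠ ∷ u) v = addresses-++ u v

address-∈ : ∀ u q ζ I v → ζ ∈ addresses (u ++ act q ζ I ∷ v)
address-∈ [] q ζ I v = here refl
address-∈ (act _ _ _ ∷ u) q ζ I v = there (address-∈ u q ζ I v)
address-∈ (✠ ∷ u) q ζ I v = address-∈ u q ζ I v

starts-snoc : ∀ B w x → StartsOK B w → StartsOK B (w ∷ʳ x)
starts-snoc (base pos _) _ x (κ , v , refl , pκ) = κ , v ∷ʳ x , refl , pκ
starts-snoc (base neg _) _ x tt = tt

prefix-path : ∀ B u v → IsPath B (u ++ v) → StartsOK B u → IsPath B u
prefix-path B u v P st = record
  { alternating = λ u₁ k k' v₁ e → IsPath.alternating P u₁ k k' (v₁ ++ v) (extend u₁ (k ∷ k' ∷ v₁) e)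
  ; justified   = λ u₁ p ζ I v₁ e → IsPath.justified P u₁ p ζ I (v₁ ++ v) (extend u₁ _ e)
  ; justInView  = λ u₁ ζ I v₁ e → IsPath.justInView P u₁ ζ I (v₁ ++ v) (extend u₁ _ e)
  ; distinct    = unique-prefix (addresses u) (subst Unique (addresses-++ u v) (IsPath.distinct P))
  ; daimonLast  = λ u₁ v₁ e → ++-conicalˡ v₁ v (IsPath.daimonLast P u₁ (v₁ ++ v) (extend u₁ (✠ ∷ v₁) e))
  ; start       = st }
  where
  extend : ∀ u₁ v₁ → u ≡ u₁ ++ v₁ → u ++ v ≡ u₁ ++ v₁ ++ v
  extend u₁ v₁ e = trans (cong (_++ v) e) (++-assoc u₁ v₁ v)

DaimonFree : List Action → Set
DaimonFree w = ∀ u v → w ≢ u ++ ✠ ∷ v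

daimon-free-at : ∀ {w} u k v → DaimonFree w → w ≡ u ++ k ∷ v → k ≢ ✠
daimon-free-at u k v df e refl = df u v e

-- A path of a list design never plays the daimon: its view would be a
-- chronicle ending with the daimon.
path-daimon-free : ∀ ξ l p → PathOf (⊢ ξ) (listD l ξ) p → DaimonFree p
path-daimon-free ξ l p (_ , V) u v e with view-last (⊢ ξ) u ✠
... | c , ec = chronicle-daimon-free c (listD-chronicle l ξ _ (subst (listD l ξ) ec inD))
  where
  inD = V (u ∷ʳ ✠) v (trans e (sym (∷ʳ-++ u ✠ v))) (++-∷≢[] u [])

-- On a positive base only the first action of a path is on the base address:
-- the first action is initial and addresses are distinct.
root-only-first : ∀ ξ p u q ζ I v → IsPath (⊢ ξ) p → p ≡ u ++ act q ζ I ∷ v → u ≢ [] → ζ ≢ ξ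
root-only-first ξ p [] q ζ I v P e ne = ⊥-elim (ne refl)
root-only-first ξ p (✠ ∷ u) q ζ I v P e _ =
  ⊥-elim (++-∷≢[] u v (IsPath.daimonLast P [] _ e))
root-only-first ξ p (act q₀ ζ₀ I₀ ∷ u) q ζ I v P e _ ζ≡ξ with IsPath.justified P [] q₀ ζ₀ I₀ _ e
... | inj₂ (_ , () , _)
... | inj₁ (ζ₀≡ξ , _) with subst (λ w → Unique (addresses w)) e (IsPath.distinct P)
...   | ζ₀∉ ∷ _ = All.lookup ζ₀∉ (address-∈ u q ζ I v) (trans ζ₀≡ξ (sym ζ≡ξ))

-- In a path of a list design every positive action but the first is off the
-- base address and justified by the action just before it (read off the view,
-- which is a chronicle).
PositivesJustified : Address → List Action → Set
PositivesJustified ξ p = ∀ u y ζ I v → p ≡ u ++ y ∷ act pos ζ I ∷ v → ζ ≢ ξ × Justifies y (act pos ζ I)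

positives-justified : ∀ ξ l p → PathOf (⊢ ξ) (listD l ξ) p → PositivesJustified ξ p
positives-justified ξ l p (P , V) u y ζ I v e = notRoot , justified
  where
  x = act pos ζ I
  e₁ : p ≡ (u ∷ʳ y) ++ x ∷ v
  e₁ = trans e (sym (∷ʳ-++ u y (x ∷ v)))
  notRoot : ζ ≢ ξ
  notRoot = root-only-first ξ p (u ∷ʳ y) pos ζ I v P e₁ (++-∷≢[] u [])
  justified : Justifies y x
  justified with view-last (⊢ ξ) u y
  ... | c , ec = chronicle-last-justified c y x (listD-chronicle l ξ _ (subst (listD l ξ) viewEq inD))
    where
    inD = V (u ∷ʳ y ∷ʳ x) v (trans e₁ (sym (∷ʳ-++ (u ∷ʳ y) x v))) (++-∷≢[] (u ∷ʳ y) [])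
    viewEq : view (⊢ ξ) (u ∷ʳ y ∷ʳ x) ≡ c ∷ʳ y ∷ʳ x
    viewEq = trans (view-positive (⊢ ξ) (u ∷ʳ y) x refl) (cong (_∷ʳ x) ec)

flipA-involutive : ∀ a → flipA (flipA a) ≡ a
flipA-involutive (act pos ζ I) = refl
flipA-involutive (act neg ζ I) = refl
flipA-involutive ✠ = refl

map-flipA-involutive : ∀ w → map flipA (map flipA w) ≡ w
map-flipA-involutive w = trans (sym (map-∘ w)) (trans (map-cong flipA-involutive w) (map-id w))

flip-split : ∀ w u k v → map flipA w ≡ u ++ k ∷ v → w ≡ map flipA u ++ flipA k ∷ map flipA v
flip-split w u k v e = begin
  w                                     ≡⟨ sym (map-flipA-involutive w) ⟩
  map flipA (map flipA w)               ≡⟨ cong (map flipA) e ⟩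
  map flipA (u ++ k ∷ v)                ≡⟨ map-++ flipA u (k ∷ v) ⟩
  map flipA u ++ flipA k ∷ map flipA v  ∎

addresses-flip : ∀ w → addresses (map flipA w) ≡ addresses w
addresses-flip [] = refl
addresses-flip (act _ ζ _ ∷ w) = cong (ζ ∷_) (addresses-flip w)
addresses-flip (✠ ∷ w) = addresses-flip w

justifies-flip : ∀ a b → Justifies a b → Justifies (flipA a) (flipA b)
justifies-flip (act p _ _) (act q _ _) (p≢q , i) = (λ e → p≢q (flipPol-injective p q e)) , i
  where
  flipPol-injective : ∀ p q → flipPol p ≡ flipPol q → p ≡ q
  flipPol-injective pos pos _ = refl
  flipPol-injective neg neg _ = refl

unflip-alternation : ∀ a b → flipA a ≢ ✠ → flipA b ≢ ✠ →
                     polarity (flipA a) ≢ polarity (flipA b) → polarity a ≢ polarity b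
unflip-alternation (act p _ _) (act q _ _) _ _ ne refl = ne refl
unflip-alternation ✠ _ a≢✠ _ _ _ = a≢✠ refl
unflip-alternation (act _ _ _) ✠ _ b≢✠ _ _ = b≢✠ refl

unflip-initial : ∀ ξ p ζ I → Initial (⊢ ξ) (act (flipPol p) ζ I) → Initial (ξ ⊢) (act p ζ I)
unflip-initial ξ pos ζ I (_ , ())
unflip-initial ξ neg ζ I (ζ≡ξ , _) = ζ≡ξ , refl

daimon-free-flip : ∀ w → DaimonFree w → DaimonFree (map flipA w)
daimon-free-flip w df u v e = df (map flipA u) (map flipA v) (flip-split w u ✠ v e)

-- The flipped sequence is self-justifying on the negative base: its negative
-- actions are the flips of the positive actions of p.
flip-self-justifying : ∀ ξ p → PositivesJustified ξ p → SelfJustifying (ξ ⊢) (map flipA p)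
flip-self-justifying ξ p pj u y (act neg ζ I) v e refl
  with pj (map flipA u) (flipA y) ζ I (map flipA v) (flip-split p u y (act neg ζ I ∷ v) e)
... | ζ≢ξ , j = (λ { (ζ≡ξ , _) → ζ≢ξ ζ≡ξ }) ,
                subst (λ a → Justifies a (act neg ζ I)) (flipA-involutive y) (justifies-flip _ _ j)

flipped-path : ∀ ξ l p → PathOf (⊢ ξ) (listD l ξ) p → IsPath (ξ ⊢) (map flipA p)
flipped-path ξ l p pp@(P , _) = record
  { alternating = alternating
  ; justified   = justified
  ; justInView  = λ u ζ I v e a a∈ _ → subst (a ∈_) (sym (ownView u _ e)) a∈
  ; distinct    = subst Unique (sym (addresses-flip p)) (IsPath.distinct P)
  ; daimonLast  = λ u v e → ⊥-elim (daimon-free-flip p df u v e)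
  ; start       = tt }
  where
  df = path-daimon-free ξ l p pp

  ownView : ∀ u v → map flipA p ≡ u ++ v → view (ξ ⊢) u ≡ u
  ownView = self-justifying-view (ξ ⊢) (map flipA p)
              (flip-self-justifying ξ p (positives-justified ξ l p pp))

  alternating : ∀ u k k' v → map flipA p ≡ u ++ k ∷ k' ∷ v → polarity k ≢ polarity k'
  alternating u k k' v e = unflip-alternation k k'
    (daimon-free-at fu (flipA k) _ df e')
    (daimon-free-at (fu ∷ʳ flipA k) (flipA k') _ df (trans e' (sym (∷ʳ-++ fu (flipA k) _))))
    (IsPath.alternating P fu (flipA k) (flipA k') (map flipA v) e')
    where
    fu = map flipA u
    e' = flip-split p u k (k' ∷ v) e

  justified : ∀ u q ζ I v → map flipA p ≡ u ++ act q ζ I ∷ v →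
              Initial (ξ ⊢) (act q ζ I) ⊎ Σ Action (λ a → (a ∈ u) × Justifies a (act q ζ I))
  justified u q ζ I v e with IsPath.justified P _ _ ζ I _ (flip-split p u (act q ζ I) v e)
  ... | inj₁ init = inj₁ (unflip-initial ξ q ζ I init)
  ... | inj₂ (a , a∈ , j) = inj₂ (flipA a ,
          subst (flipA a ∈_) (map-flipA-involutive u) (∈-map⁺ flipA a∈) ,
          subst (Justifies (flipA a)) (flipA-involutive (act q ζ I)) (justifies-flip _ _ j))

daimon-extension : ∀ B w x → IsPath B (w ∷ʳ x) → DaimonFree (w ∷ʳ x) → polarity x ≡ neg →
                   IsPath B (w ∷ʳ x ∷ʳ ✠)
daimon-extension B w x P df px = record
  { alternating = alternating
  ; justified   = λ u q ζ I v e → let (v' , e') = proper-position u _ v (λ ()) e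
                                  in IsPath.justified P u q ζ I v' e'
  ; justInView  = λ u ζ I v e → let (v' , e') = proper-position u _ v (λ ()) e
                                in IsPath.justInView P u ζ I v' e'
  ; distinct    = subst Unique (sym (trans (addresses-++ xs [ ✠ ]) (++-identityʳ (addresses xs))))
                        (IsPath.distinct P)
  ; daimonLast  = daimonLast
  ; start       = starts-snoc B xs ✠ (IsPath.start P) }
  where
  xs = w ∷ʳ x

  proper-position : ∀ u k v → k ≢ ✠ → xs ∷ʳ ✠ ≡ u ++ k ∷ v → Σ (List Action) λ v' → xs ≡ u ++ k ∷ v'
  proper-position u k v k≢✠ e with ∷ʳ-split xs ✠ u k v e
  ... | inj₁ (_ , k≡✠ , _) = ⊥-elim (k≢✠ k≡✠)
  ... | inj₂ found = found

  alternating : ∀ u k k' v → xs ∷ʳ ✠ ≡ u ++ k ∷ k' ∷ v → polarity k ≢ polarity k'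
  alternating u k k' v e with ∷ʳ-split xs ✠ (u ∷ʳ k) k' v (trans e (sym (∷ʳ-++ u k (k' ∷ v))))
  ... | inj₁ (e' , refl , _) rewrite ∷ʳ-injectiveʳ u w e' = λ pk → neg≢pos (trans (sym px) pk)
    where
    neg≢pos : neg ≢ pos
    neg≢pos ()
  ... | inj₂ (v' , e') = IsPath.alternating P u k k' v' (trans e' (∷ʳ-++ u k (k' ∷ v')))

  daimonLast : ∀ u v → xs ∷ʳ ✠ ≡ u ++ ✠ ∷ v → v ≡ []
  daimonLast u v e with ∷ʳ-split xs ✠ u ✠ v e
  ... | inj₁ (_ , _ , v≡[]) = v≡[]
  ... | inj₂ (v' , e') = ⊥-elim (df u v' e')

daimonAfter : Pol → List Action
daimonAfter pos = [ ✠ ]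
daimonAfter neg = []

dual-cons : ∀ y κ w → dual (y ∷ κ ∷ w) ≡ flipA y ∷ dual (κ ∷ w)
dual-cons (act pos _ _) κ w = refl
dual-cons (act neg _ _) κ w = refl
dual-cons ✠ κ w = refl

dual-snoc : ∀ w p ζ I → dual (w ∷ʳ act p ζ I) ≡ map flipA w ∷ʳ act (flipPol p) ζ I ++ daimonAfter p
dual-snoc [] pos ζ I = refl
dual-snoc [] neg ζ I = refl
dual-snoc (y ∷ []) p ζ I = trans (dual-cons y _ []) (cong (flipA y ∷_) (dual-snoc [] p ζ I))
dual-snoc (y ∷ y' ∷ w) p ζ I = trans (dual-cons y y' _) (cong (flipA y ∷_) (dual-snoc (y' ∷ w) p ζ I))

dual-path : ∀ ξ l p → PathOf (⊢ ξ) (listD l ξ) p → IsPath (ξ ⊢) (dual p)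
dual-path ξ l p pp with initLast p
dual-path ξ l _ (P , _) | [] with IsPath.start P
... | _ , _ , () , _
dual-path ξ l _ pp | w ∷ʳ′ ✠ = ⊥-elim (path-daimon-free ξ l _ pp w [] refl)
dual-path ξ l _ pp | w ∷ʳ′ act pos ζ I =
  subst (IsPath (ξ ⊢)) (sym (dual-snoc w pos ζ I))
    (daimon-extension (ξ ⊢) (map flipA w) (act neg ζ I) flipped
      (subst DaimonFree flip-snoc (daimon-free-flip _ (path-daimon-free ξ l _ pp))) refl)
  where
  flip-snoc = map-++ flipA w [ act pos ζ I ]
  flipped = subst (IsPath (ξ ⊢)) flip-snoc (flipped-path ξ l _ pp)
dual-path ξ l _ pp | w ∷ʳ′ act neg ζ I =
  subst (IsPath (ξ ⊢)) (sym (trans (dual-snoc w neg ζ I) (++-identityʳ _)))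
    (subst (IsPath (ξ ⊢)) (map-++ flipA w [ act neg ζ I ]) (flipped-path ξ l _ pp))

-- If w κ⁻ is a prefix of a path of D_l and w is a path of D_cs, then w κ⁻ is
-- a path of D_cs: the view of w κ⁻ is the view of a prefix of w (a chronicle
-- of D_cs) followed by κ⁻, and negative-extension transfers it from D_l.
negative-step : ∀ ξ l cs p w ζ I v → PathOf (⊢ ξ) (listD l ξ) p → p ≡ w ++ act neg ζ I ∷ v →
                PathOf (⊢ ξ) (listD cs ξ) w → PathOf (⊢ ξ) (listD cs ξ) (w ∷ʳ act neg ζ I)
negative-step ξ l cs p w ζ I v (P , V) e (Pw , Vw) = path , views
  where
  x = act neg ζ I
  e' : p ≡ (w ∷ʳ x) ++ v
  e' = trans e (sym (∷ʳ-++ w x v))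

  path : IsPath (⊢ ξ) (w ∷ʳ x)
  path = prefix-path (⊢ ξ) (w ∷ʳ x) v (subst (IsPath (⊢ ξ)) e' P)
                     (starts-snoc (⊢ ξ) w x (IsPath.start Pw))

  inD : listD l ξ (view (⊢ ξ) (w ∷ʳ x))
  inD = V (w ∷ʳ x) v e' (++-∷≢[] w [])

  lastView : listD cs ξ (view (⊢ ξ) (w ∷ʳ x))
  lastView with view-negative ξ w ζ I
  ... | inj₁ eq = ⊥-elim (chronicle-negative-first (listD-chronicle l ξ _ (subst (listD l ξ) eq inD)))
  ... | inj₂ (w₀ , w₁ , ew , ne , eq) = subst (listD cs ξ) (sym eq)
          (negative-extension l cs ξ _ ζ I (subst (listD l ξ) eq inD) (Vw w₀ w₁ ew ne))

  views : ∀ u v' → w ∷ʳ x ≡ u ++ v' → u ≢ [] → listD cs ξ (view (⊢ ξ) u)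
  views u v' eq ne with ∷ʳ-prefix w x u v' eq
  ... | inj₁ refl = lastView
  ... | inj₂ (v'' , ew) = Vw u v'' ew ne

listD-visitable : ∀ ξ l p → PathOf (⊢ ξ) (listD l ξ) p → Visitable ξ (λ cs → listD cs ξ) p
listD-visitable ξ l p pp =
  dual-path ξ l p pp , λ w ζ I v e cs → negative-step ξ l cs p w ζ I v pp e

mainTheorem17 : (ξ : Address) (n : ℕ) (as : Vec ℕ n) (p : List Action) →
                PathOf (⊢ ξ) (𝕃 ξ n as) p → Visitable ξ (𝕃 ξ n) p
mainTheorem17 ξ n as p pp with listD-visitable ξ (toList as) p pp
... | dualIsPath , extends = dualIsPath , λ w ζ I v e bs → extends w ζ I v e (toList bs)
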